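{- For any $n\in\mathbb{N}$, there is a hypergraph $H$ with $|V(H)|=n$ such that every interval in the lazy burning distribution of $H$ is nonempty.
   Context: A hypergraph $H=(V(H),E(H))$ has a finite nonempty vertex set and a finite collection $E(H)$ of subsets of $V(H)$ called edges (parallel edges allowed). For a proportion $p\in(0,1)$, the proportion-based propagation rule is: if at some time step at least $\lceil p|e|\rceil$ vertices of an edge $e$ are on fire, then in the next time step all vertices of $e$ catch fire; burned vertices stay burned. A set $S\subseteq V(H)$ is a lazy burning set if, setting all of $S$ on fire at once and then repeatedly applying the propagation rule, every vertex eventually catches fire; $b_{L,p}(H)$ is the minimum size of a lazy burning set. If $|V(H)|=n$, the lazy burning distribution of $H$ is the partition of $(0,1)$ into the $n$ (possibly empty) sets $Q_1,\ldots,Q_n$, where $Q_j=\{p\in(0,1) : b_{L,p}(H)=j\}$; these sets are intervals. -}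

module Defs where

open import Data.Nat as ℕ using (ℕ; zero; suc; _≤_)
open import Data.Integer as ℤ using (ℤ; +_)
open import Data.Rational as ℚ using (ℚ; _/_; ceiling)
open import Data.Fin using (Fin)
open import Data.Fin.Subset using (Subset; _∩_; _∪_; ∣_∣; ⊤; ⊥)
open import Data.List using (List; foldr)
open import Data.Product using (Σ; _×_)
open import Data.Bool using (if_then_else_)
open import Relation.Nullary.Decidable using (⌊_⌋)
open import Relation.Binary.PropositionalEquality using (_≡_)

-- A hypergraph with vertex set Fin n (so |V(H)| = n) and a finite
-- collection (list, parallel edges allowed) of edges, each a subset of V(H).
record Hypergraph (n : ℕ) : Set where
  field
    edges : List (Subset n)
open Hypergraph public

threshold : ℚ → ℕ → ℤ
threshold p k = ceiling (p ℚ.* (+ k / 1))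

ignites : {n : ℕ} → ℚ → Subset n → Subset n → Set
ignites p B e = threshold p ∣ e ∣ ℤ.≤ + ∣ B ∩ e ∣

step : {n : ℕ} → Hypergraph n → ℚ → Subset n → Subset n
step H p B = foldr (λ e acc → if ⌊ threshold p ∣ e ∣ ℤ.≤? + ∣ B ∩ e ∣ ⌋ then e ∪ acc else acc) B (edges H)

burnedAfter : {n : ℕ} → Hypergraph n → ℚ → Subset n → ℕ → Subset n
burnedAfter H p S zero = S
burnedAfter H p S (suc t) = step H p (burnedAfter H p S t)

IsLazyBurningSet : {n : ℕ} → Hypergraph n → ℚ → Subset n → Set
IsLazyBurningSet H p S = Σ ℕ λ t → burnedAfter H p S t ≡ ⊤

LazyBurningNumber : {n : ℕ} → Hypergraph n → ℚ → ℕ → Set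
LazyBurningNumber {n} H p j =
  (Σ (Subset n) λ S → IsLazyBurningSet H p S × ∣ S ∣ ≡ j)
  × ((S : Subset n) → IsLazyBurningSet H p S → j ≤ ∣ S ∣)

-- Take the hypergraph whose only edge is V(H). A set with fewer than ⌈pn⌉
-- vertices never spreads, while ⌈pn⌉ vertices ignite the edge at once, so
-- b_{L,p}(H) = ⌈pn⌉; and p = (2j−1)/(2n) ∈ (0,1) gives ⌈pn⌉ = j for 1 ≤ j ≤ n.
module Submission where

open import Defs
open import Data.Nat as ℕ using (ℕ; zero; suc; z≤n; s≤s; _≤_)
import Data.Nat.Properties as ℕ
open import Data.Nat.Tactic.RingSolver using (solve-∀)
open import Data.Integer as ℤ using (+_; +≤+; +<+)
import Data.Integer.Properties as ℤ
open import Data.Integer.DivMod using (_/ℕ_; [n/d]*d≤n; n<s[n/ℕd]*d; div-pos-is-/ℕ)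
open import Data.Rational as ℚ using (ℚ; 0ℚ; 1ℚ; _<_; ↥_; ↧_; ↧ₙ_; floor; ceiling; toℚᵘ; fromℚᵘ)
open import Data.Rational.Properties
  using (↥-neg; ↧-neg; toℚᵘ-fromℚᵘ; toℚᵘ-homo-*; toℚᵘ-cancel-<)
open import Data.Rational.Unnormalised as ℚᵘ using (ℚᵘ; mkℚᵘ; *≤*; *<*)
import Data.Rational.Unnormalised.Properties as ℚᵘ
open import Data.Fin.Subset using (Subset; outside; inside; _∩_; ∣_∣; ⊤)
open import Data.Fin.Subset.Properties using (∣⊤∣≡n; ∩-identityʳ; ∪-zeroˡ)
open import Data.Vec using ([]; _∷_)
open import Data.List using ([]; _∷_)
open import Data.Product using (Σ; _×_; _,_)
open import Data.Sum using (_⊎_; inj₁; inj₂)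
open import Data.Empty using (⊥-elim)
open import Function using (_⇔_; mk⇔; Equivalence)
open import Relation.Nullary using (¬_; yes; no)
open import Relation.Binary.PropositionalEquality

floor-greatest : ∀ q {m} → m ℤ.* ↧ q ℤ.≤ ↥ q → m ℤ.≤ floor q
floor-greatest q@record{} {m} m↧q≤↥q =
  subst (m ℤ.≤_) (trans (ℤ.pred-suc (↥ q /ℕ ↧ₙ q)) (sym (div-pos-is-/ℕ (↥ q) (↧ₙ q))))
    (ℤ.i<j⇒i≤pred[j] {j = ℤ.suc (↥ q /ℕ ↧ₙ q)} (ℤ.*-cancelʳ-<-nonNeg (↧ q)
      (ℤ.≤-<-trans m↧q≤↥q (n<s[n/ℕd]*d (↥ q) (↧ₙ q)))))

floor-< : ∀ q {m} → ↥ q ℤ.< m ℤ.* ↧ q → floor q ℤ.< m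
floor-< q@record{} ↥q<m↧q =
  ℤ.*-cancelʳ-<-nonNeg (↧ q) (ℤ.≤-<-trans ([n/d]*d≤n (↥ q) (↧ q)) ↥q<m↧q)

ceiling-least : ∀ q {m} → ↥ q ℤ.≤ m ℤ.* ↧ q → ceiling q ℤ.≤ m
ceiling-least q@record{} {m} ↥q≤m↧q =
  subst (ℤ.- floor (ℚ.- q) ℤ.≤_) (ℤ.neg-involutive m) (ℤ.neg-mono-≤ (floor-greatest (ℚ.- q)
    (subst₂ ℤ._≤_ (trans (ℤ.neg-distribˡ-* m (↧ q)) (cong ((ℤ.- m) ℤ.*_) (sym (↧-neg q))))
                  (sym (↥-neg q))
                  (ℤ.neg-mono-≤ ↥q≤m↧q))))

<-ceiling : ∀ q {k} → k ℤ.* ↧ q ℤ.< ↥ q → k ℤ.< ceiling q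
<-ceiling q@record{} {k} k↧q<↥q =
  subst (ℤ._< ℤ.- floor (ℚ.- q)) (ℤ.neg-involutive k) (ℤ.neg-mono-< (floor-< (ℚ.- q)
    (subst₂ ℤ._<_ (sym (↥-neg q))
                  (trans (ℤ.neg-distribˡ-* k (↧ q)) (cong ((ℤ.- k) ℤ.*_) (sym (↧-neg q))))
                  (ℤ.neg-mono-< k↧q<↥q))))

ceiling-unique : ∀ q {k} → mkℚᵘ k 0 ℚᵘ.< toℚᵘ q → toℚᵘ q ℚᵘ.≤ mkℚᵘ (ℤ.suc k) 0 →
                 ceiling q ≡ ℤ.suc k
ceiling-unique q@record{} {k} (*<* k<q) (*≤* q≤k+1) = ℤ.≤-antisym
  (ceiling-least q {ℤ.suc k} (subst (ℤ._≤ ℤ.suc k ℤ.* ↧ q) (ℤ.*-identityʳ (↥ q)) q≤k+1))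
  (ℤ.i<j⇒suc[i]≤j (<-ceiling q {k} (subst (k ℤ.* ↧ q ℤ.<_) (ℤ.*-identityʳ (↥ q)) k<q)))

fromℚᵘ-mono-< : ∀ {p q} → p ℚᵘ.< q → fromℚᵘ p < fromℚᵘ q
fromℚᵘ-mono-< {p} {q} p<q = toℚᵘ-cancel-<
  (ℚᵘ.<-respʳ-≃ (ℚᵘ.≃-sym (toℚᵘ-fromℚᵘ q)) (ℚᵘ.<-respˡ-≃ (ℚᵘ.≃-sym (toℚᵘ-fromℚᵘ p)) p<q))

-- The midpoint (2j+1)/(2n+2) of the interval (j/(n+1), (j+1)/(n+1)] on which
-- ⌈p (n+1)⌉ = j+1.
proportionᵘ : ℕ → ℕ → ℚᵘ
proportionᵘ j n = mkℚᵘ (+ suc (2 ℕ.* j)) (suc (2 ℕ.* n))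

proportion : ℕ → ℕ → ℚ
proportion j n = fromℚᵘ (proportionᵘ j n)

0<proportion : ∀ j n → 0ℚ < proportion j n
0<proportion j n = fromℚᵘ-mono-< {p = mkℚᵘ (+ 0) 0} {q = proportionᵘ j n} (*<* (+<+ (s≤s z≤n)))

proportion<1 : ∀ {j n} → j ≤ n → proportion j n < 1ℚ
proportion<1 {j} {n} j≤n =
  fromℚᵘ-mono-< {p = proportionᵘ j n} {q = mkℚᵘ (+ 1) 0} (*<* (+<+ (s≤s (s≤s (begin
    2 ℕ.* j ℕ.* 1   ≡⟨ ℕ.*-identityʳ (2 ℕ.* j) ⟩
    2 ℕ.* j         ≤⟨ ℕ.*-monoʳ-≤ 2 j≤n ⟩
    2 ℕ.* n         ≡⟨ ℕ.+-identityʳ (2 ℕ.* n) ⟨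
    2 ℕ.* n ℕ.+ 0   ∎)))))
  where open ℕ.≤-Reasoning

j*[2+2n]+[1+n]≡[1+2j]*[1+n] : ∀ j n → j ℕ.* suc (suc (2 ℕ.* n)) ℕ.+ suc n ≡ suc (2 ℕ.* j) ℕ.* suc n
j*[2+2n]+[1+n]≡[1+2j]*[1+n] = solve-∀

[1+2j]*[1+n]+[1+n]≡[1+j]*[2+2n] : ∀ j n → suc (2 ℕ.* j) ℕ.* suc n ℕ.+ suc n ≡ suc j ℕ.* suc (suc (2 ℕ.* n))
[1+2j]*[1+n]+[1+n]≡[1+j]*[2+2n] = solve-∀

-- The trailing factors ℕ.* 1 are the denominator of mkℚᵘ (+ suc n) 0.
proportionᵘ*-≤ : ∀ j n → proportionᵘ j n ℚᵘ.* mkℚᵘ (+ suc n) 0 ℚᵘ.≤ mkℚᵘ (+ suc j) 0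
proportionᵘ*-≤ j n = *≤* (+≤+ (begin
  suc (2 ℕ.* j) ℕ.* suc n ℕ.* 1          ≡⟨ ℕ.*-identityʳ _ ⟩
  suc (2 ℕ.* j) ℕ.* suc n                ≤⟨ ℕ.m≤m+n _ (suc n) ⟩
  suc (2 ℕ.* j) ℕ.* suc n ℕ.+ suc n      ≡⟨ [1+2j]*[1+n]+[1+n]≡[1+j]*[2+2n] j n ⟩
  suc j ℕ.* suc (suc (2 ℕ.* n))          ≡⟨ cong (λ d → suc j ℕ.* suc (suc d)) (ℕ.*-identityʳ (2 ℕ.* n)) ⟨
  suc j ℕ.* suc (suc (2 ℕ.* n ℕ.* 1))    ∎))
  where open ℕ.≤-Reasoning

<-proportionᵘ* : ∀ j n → mkℚᵘ (+ j) 0 ℚᵘ.< proportionᵘ j n ℚᵘ.* mkℚᵘ (+ suc n) 0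
-- For a variable j the sign of + j blocks the reduction of + j ℤ.* _, hence the split.
<-proportionᵘ* zero    n = *<* (+<+ (s≤s z≤n))
<-proportionᵘ* j@(suc _) n = *<* (+<+ (begin-strict
  j ℕ.* suc (suc (2 ℕ.* n ℕ.* 1))        ≡⟨ cong (λ d → j ℕ.* suc (suc d)) (ℕ.*-identityʳ (2 ℕ.* n)) ⟩
  j ℕ.* suc (suc (2 ℕ.* n))              <⟨ ℕ.m<m+n _ (s≤s z≤n) ⟩
  j ℕ.* suc (suc (2 ℕ.* n)) ℕ.+ suc n    ≡⟨ j*[2+2n]+[1+n]≡[1+2j]*[1+n] j n ⟩
  suc (2 ℕ.* j) ℕ.* suc n                ≡⟨ ℕ.*-identityʳ _ ⟨
  suc (2 ℕ.* j) ℕ.* suc n ℕ.* 1          ∎))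
  where open ℕ.≤-Reasoning

threshold-proportion : ∀ j n → threshold (proportion j n) (suc n) ≡ + suc j
threshold-proportion j n = ceiling-unique (proportion j n ℚ.* (+ suc n ℚ./ 1))
  (ℚᵘ.<-respʳ-≃ (ℚᵘ.≃-sym toℚᵘ-p*n≃) (<-proportionᵘ* j n))
  (ℚᵘ.≤-respˡ-≃ (ℚᵘ.≃-sym toℚᵘ-p*n≃) (proportionᵘ*-≤ j n))
  where
  toℚᵘ-p*n≃ : toℚᵘ (proportion j n ℚ.* (+ suc n ℚ./ 1)) ℚᵘ.≃ proportionᵘ j n ℚᵘ.* mkℚᵘ (+ suc n) 0
  toℚᵘ-p*n≃ = ℚᵘ.≃-trans (toℚᵘ-homo-* (proportion j n) (+ suc n ℚ./ 1))
    (ℚᵘ.*-cong (toℚᵘ-fromℚᵘ (proportionᵘ j n)) (toℚᵘ-fromℚᵘ (mkℚᵘ (+ suc n) 0)))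

burnedAfter-fixedPoint : ∀ {n} (H : Hypergraph n) p {S} → step H p S ≡ S → ∀ t → burnedAfter H p S t ≡ S
burnedAfter-fixedPoint H p step≡ zero    = refl
burnedAfter-fixedPoint H p step≡ (suc t) = trans (cong (step H p) (burnedAfter-fixedPoint H p step≡ t)) step≡

firstVertices : ∀ {n} → ℕ → Subset n
firstVertices {zero}  k       = []
firstVertices {suc n} zero    = outside ∷ firstVertices zero
firstVertices {suc n} (suc k) = inside ∷ firstVertices k

∣firstVertices∣ : ∀ {n k} → k ≤ n → ∣ firstVertices {n} k ∣ ≡ k
∣firstVertices∣ {zero}  z≤n       = refl
∣firstVertices∣ {suc n} z≤n       = ∣firstVertices∣ {n} z≤n
∣firstVertices∣ {suc n} (s≤s k≤n) = cong suc (∣firstVertices∣ k≤n)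

singleEdge : (n : ℕ) → Hypergraph n
singleEdge n = record { edges = ⊤ ∷ [] }

ignites-⊤⇔ : ∀ {n j} p (B : Subset n) → threshold p n ≡ + j → ignites p B ⊤ ⇔ j ≤ ∣ B ∣
ignites-⊤⇔ {n} {j} p B th≡j = subst (_⇔ j ≤ ∣ B ∣) (sym ignites≡) (mk⇔ ℤ.drop‿+≤+ +≤+)
  where
  ignites≡ : ignites p B ⊤ ≡ (+ j ℤ.≤ + ∣ B ∣)
  ignites≡ = cong₂ (λ k C → k ℤ.≤ + ∣ C ∣) (trans (cong (threshold p) (∣⊤∣≡n n)) th≡j) (∩-identityʳ B)

step-singleEdge-ignites : ∀ {n} p (B : Subset n) → ignites p B ⊤ → step (singleEdge n) p B ≡ ⊤
step-singleEdge-ignites {n} p B ig with threshold p ∣ ⊤ {n} ∣ ℤ.≤? + ∣ B ∩ ⊤ ∣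
... | yes _   = ∪-zeroˡ B
... | no ¬ig = ⊥-elim (¬ig ig)

step-singleEdge-¬ignites : ∀ {n} p (B : Subset n) → ¬ ignites p B ⊤ → step (singleEdge n) p B ≡ B
step-singleEdge-¬ignites {n} p B ¬ig with threshold p ∣ ⊤ {n} ∣ ℤ.≤? + ∣ B ∩ ⊤ ∣
... | yes ig = ⊥-elim (¬ig ig)
... | no _   = refl

lazyBurningSet-singleEdge : ∀ {n} p (S : Subset n) → IsLazyBurningSet (singleEdge n) p S →
                            ignites p S ⊤ ⊎ S ≡ ⊤
lazyBurningSet-singleEdge {n} p S (t , burnt) with threshold p ∣ ⊤ {n} ∣ ℤ.≤? + ∣ S ∩ ⊤ ∣
... | yes ig = inj₁ ig
... | no ¬ig = inj₂ (trans (sym (burnedAfter-fixedPoint (singleEdge n) p S-fixed t)) burnt)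
  where
  S-fixed : step (singleEdge n) p S ≡ S
  S-fixed = step-singleEdge-¬ignites p S ¬ig

lazyBurningNumber-singleEdge : ∀ {n j} p → threshold p n ≡ + j → j ≤ n →
                               LazyBurningNumber (singleEdge n) p j
lazyBurningNumber-singleEdge {n} {j} p th≡j j≤n =
  (S₀ , (1 , step-singleEdge-ignites p S₀ ignites-S₀) , ∣firstVertices∣ j≤n) , minimal
  where
  S₀ : Subset n
  S₀ = firstVertices j
  ignites-S₀ : ignites p S₀ ⊤
  ignites-S₀ = Equivalence.from (ignites-⊤⇔ p S₀ th≡j) (ℕ.≤-reflexive (sym (∣firstVertices∣ j≤n)))
  minimal : ∀ S → IsLazyBurningSet (singleEdge n) p S → j ≤ ∣ S ∣
  minimal S burning with lazyBurningSet-singleEdge p S burning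
  ... | inj₁ ig   = Equivalence.to (ignites-⊤⇔ p S th≡j) ig
  ... | inj₂ refl = subst (j ≤_) (sym (∣⊤∣≡n n)) j≤n

lemma3p2 : (n : ℕ) → 1 ≤ n →
    Σ (Hypergraph n) λ H →
      (j : ℕ) → 1 ≤ j → j ≤ n →
        Σ ℚ λ p → (0ℚ < p) × (p < 1ℚ) × LazyBurningNumber H p j
lemma3p2 (suc n) _ = singleEdge (suc n) , λ where
  (suc j) _ (s≤s j≤n) →
    proportion j n , 0<proportion j n , proportion<1 j≤n ,
    lazyBurningNumber-singleEdge (proportion j n) (threshold-proportion j n) (s≤s j≤n)
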